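{- For every integer $m\ge1$, the coefficient of each term $w$ of $Y\cdot P^m\cdot Y\in B^{\otimes(m+1)}$ equals $2^{\#_Z(w)}$, where $\#_Z(w)$ is the number of occurrences of the letter $Z$ in $w$.
   Context: Let $\mathcal M=\mathbb Z\langle y,n\rangle/(yn=ny=n,\ n^2=0,\ y^2=y)$. In the ring $\mathcal M\otimes\mathcal M$ (tensor over $\mathbb Z$, with $(a\otimes b)(c\otimes d)=ac\otimes bd$) put $X=y\otimes n+n\otimes y$, $Y=y\otimes y$, $Z=n\otimes n$, and let $B$ be the $\mathbb Z$-span of $X,Y,Z$: a commutative subring, free abelian with basis $X,Y,Z$, with $X^2=2Z$, $Y^2=Y$, $Z^2=0$, $XY=YX=X$, $XZ=ZX=0$, $YZ=ZY=Z$. For $r\ge1$, $B^{\otimes r}$ is free abelian with basis the words $w_1\otimes\cdots\otimes w_r$, $w_i\in\{X,Y,Z\}$; writing $u\in B^{\otimes r}$ uniquely as $\sum_w c_w w$, a term of $u$ is a word $w$ with $c_w\ne0$, and $c_w$ is its coefficient. The chaining product $B^{\otimes r}\times B^{\otimes s}\to B^{\otimes(r+s-1)}$ is the bilinear (associative) map $(a_1\otimes\cdots\otimes a_r)\cdot(b_1\otimes\cdots\otimes b_s)=a_1\otimes\cdots\otimes a_{r-1}\otimes(a_rb_1)\otimes b_2\otimes\cdots\otimes b_s$. Elements of $B$ are regarded as elements of $B^{\otimes1}$. Let $P=X\otimes Y+Y\otimes X\in B^{\otimes2}$ and let $P^m\in B^{\otimes(m+1)}$ be its $m$-fold chaining product.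 -}

module Defs where

open import Data.Nat as ℕ using (ℕ; zero; suc; _+_)
open import Data.Nat.Properties using (+-identityʳ)
open import Data.Integer as ℤ using (ℤ; +_)
open import Data.Product using (_×_; _,_)
open import Data.List using (List; []; _∷_; map; concatMap; _++_)
open import Data.Vec using (Vec; []; _∷_)
open import Data.Vec.Properties using (≡-dec)
open import Relation.Binary.PropositionalEquality using (_≡_; refl; subst)
open import Relation.Nullary using (Dec; yes; no)

data Letter : Set where
  X Y Z : Letter

_≟L_ : (a b : Letter) → Dec (a ≡ b)
X ≟L X = yes refl
X ≟L Y = no (λ ())
X ≟L Z = no (λ ())
Y ≟L X = no (λ ())
Y ≟L Y = yes refl
Y ≟L Z = no (λ ())
Z ≟L X = no (λ ())
Z ≟L Y = no (λ ())
Z ≟L Z = yes refl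

mulL : Letter → Letter → List (ℤ × Letter)
mulL X X = (+ 2 , Z) ∷ []
mulL X Y = (+ 1 , X) ∷ []
mulL X Z = []
mulL Y X = (+ 1 , X) ∷ []
mulL Y Y = (+ 1 , Y) ∷ []
mulL Y Z = (+ 1 , Z) ∷ []
mulL Z X = []
mulL Z Y = (+ 1 , Z) ∷ []
mulL Z Z = []

Word : ℕ → Set
Word r = Vec Letter r

-- An element of B^{⊗r}, presented as a formal Z-linear combination of words
-- (a finite list of (coefficient, word) pairs; repetitions are allowed and summed).
Tensor : ℕ → Set
Tensor r = List (ℤ × Word r)

coeff : ∀ {r} → Tensor r → Word r → ℤ
coeff [] w = + 0
coeff ((c , v) ∷ u) w with ≡-dec _≟L_ v w
... | yes _ = c ℤ.+ coeff u w
... | no  _ = coeff u w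

-- Chaining product of two basis words: a₁…a_{r-1} (a_r b₁) b₂…b_s.
chainW : ∀ {r s} → Word (suc r) → Word (suc s) → Tensor (suc (r + s))
chainW (a ∷ []) (b ∷ bs) = map (λ { (c , l) → (c , l ∷ bs) }) (mulL a b)
chainW (a ∷ a′ ∷ as) bs =
  map (λ { (c , v) → (c , a ∷ v) }) (chainW (a′ ∷ as) bs)

_·_ : ∀ {r s} → Tensor (suc r) → Tensor (suc s) → Tensor (suc (r + s))
u · v = concatMap (λ { (c , a) → concatMap (λ { (d , b) →
          map (λ { (e , w) → (c ℤ.* d ℤ.* e , w) }) (chainW a b) }) v }) u

infixl 7 _·_

Yt : Tensor 1
Yt = (+ 1 , Y ∷ []) ∷ []

P : Tensor 2
P = (+ 1 , X ∷ Y ∷ []) ∷ (+ 1 , Y ∷ X ∷ []) ∷ []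

-- P^m ∈ B^{⊗(m+1)}, the m-fold chaining product (P^{m+1} = P · P^m, by associativity).
-- The value at m = 0 (set to Y, the unit of B) is never used in the statement.
Ppow : (m : ℕ) → Tensor (suc m)
Ppow zero = Yt
Ppow (suc m) = P · Ppow m

YPY : (m : ℕ) → Tensor (suc m)
YPY m = subst (λ k → Tensor (suc k)) (+-identityʳ m) ((Yt · Ppow m) · Yt)

#Z : ∀ {r} → Word r → ℕ
#Z [] = 0
#Z (Z ∷ w) = suc (#Z w)
#Z (X ∷ w) = #Z w
#Z (Y ∷ w) = #Z w

-- A tensor u acts on functions f from words to ℤ by ⟪ u ∣ f ⟫ = Σ_w c_w f(w), and coeff u w is
-- its value on the Kronecker delta δ w.  The chaining product is bilinear, so ⟪ u · v ∣ f ⟫ is a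
-- double sum of pairings with chained basis words, which for the tensors Y, X and P can be
-- computed letter by letter: Y is a two-sided unit, and P · T = X ⊗ T + Y ⊗ (X · T), where
-- X · T carries the coefficient of T at Y w to X w and twice its coefficient at X w to Z w
-- (XY = X, XX = 2Z).  So every coefficient of P · T is 0, a coefficient of T at a word with as
-- many Z's, or twice a coefficient of T at a word with one Z fewer; starting from P⁰ = Y, every
-- coefficient of P^m is 0 or 2^#Z.

module Submission where

open import Defs
open import Data.Nat as ℕ using (ℕ; zero; suc; _≤_; _^_)
open import Data.Nat.Properties using (+-identityʳ)
open import Data.Integer using (ℤ; +_; _+_; _*_)
import Data.Integer.Properties as ℤ
open import Data.Product using (_×_; _,_)
open import Data.Sum using (_⊎_; inj₁; inj₂)
open import Data.List using (List; []; _∷_; map; _++_; concatMap)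
open import Data.List.Properties using (concatMap-++)
open import Data.Vec using ([]; _∷_)
open import Data.Vec.Properties using (≡-dec)
open import Function using (_∘_)
open import Relation.Nullary using (yes; no; contradiction)
open import Relation.Binary.PropositionalEquality
  using (_≡_; _≢_; refl; sym; trans; cong; cong₂; subst; _≗_; module ≡-Reasoning)
open import Relation.Binary.PropositionalEquality.Properties using (subst-subst-sym)
open import Algebra.Properties.CommutativeSemigroup ℤ.*-commutativeSemigroup using (x∙yz≈y∙xz)

open ≡-Reasoning

private
  variable
    A B : Set
    r s : ℕ

⟪_∣_⟫ : List (ℤ × A) → (A → ℤ) → ℤ
⟪ []          ∣ f ⟫ = + 0
⟪ (c , x) ∷ u ∣ f ⟫ = c * f x + ⟪ u ∣ f ⟫

basis : A → List (ℤ × A)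
basis x = (+ 1 , x) ∷ []

⟪⟫-cong : ∀ (u : List (ℤ × A)) {f g} → f ≗ g → ⟪ u ∣ f ⟫ ≡ ⟪ u ∣ g ⟫
⟪⟫-cong []            f≗g = refl
⟪⟫-cong ((c , x) ∷ u) f≗g = cong₂ (λ a b → c * a + b) (f≗g x) (⟪⟫-cong u f≗g)

⟪⟫-basis : ∀ (x : A) f → ⟪ basis x ∣ f ⟫ ≡ f x
⟪⟫-basis x f = trans (ℤ.+-identityʳ _) (ℤ.*-identityˡ (f x))

⟪⟫-zero : ∀ (u : List (ℤ × A)) → ⟪ u ∣ (λ _ → + 0) ⟫ ≡ + 0
⟪⟫-zero []            = refl
⟪⟫-zero ((c , x) ∷ u) = cong₂ _+_ (ℤ.*-zeroʳ c) (⟪⟫-zero u)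

⟪⟫-scale : ∀ (u : List (ℤ × A)) k f → ⟪ u ∣ (λ x → k * f x) ⟫ ≡ k * ⟪ u ∣ f ⟫
⟪⟫-scale []            k f = sym (ℤ.*-zeroʳ k)
⟪⟫-scale ((c , x) ∷ u) k f = begin
  c * (k * f x) + ⟪ u ∣ (λ x → k * f x) ⟫ ≡⟨ cong₂ _+_ (x∙yz≈y∙xz c k (f x)) (⟪⟫-scale u k f) ⟩
  k * (c * f x) + k * ⟪ u ∣ f ⟫           ≡⟨ ℤ.*-distribˡ-+ k _ _ ⟨
  k * (c * f x + ⟪ u ∣ f ⟫)               ∎

⟪⟫-map-scale : ∀ (u : List (ℤ × A)) k f →
  ⟪ map (λ { (c , x) → (k * c , x) }) u ∣ f ⟫ ≡ k * ⟪ u ∣ f ⟫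
⟪⟫-map-scale []            k f = sym (ℤ.*-zeroʳ k)
⟪⟫-map-scale ((c , x) ∷ u) k f = begin
  k * c * f x + ⟪ map _ u ∣ f ⟫ ≡⟨ cong₂ _+_ (ℤ.*-assoc k c (f x)) (⟪⟫-map-scale u k f) ⟩
  k * (c * f x) + k * ⟪ u ∣ f ⟫ ≡⟨ ℤ.*-distribˡ-+ k _ _ ⟨
  k * (c * f x + ⟪ u ∣ f ⟫)     ∎

⟪⟫-map : ∀ (u : List (ℤ × A)) (g : A → B) f →
  ⟪ map (λ { (c , x) → (c , g x) }) u ∣ f ⟫ ≡ ⟪ u ∣ f ∘ g ⟫
⟪⟫-map []            g f = refl
⟪⟫-map ((c , x) ∷ u) g f = cong (λ t → c * f (g x) + t) (⟪⟫-map u g f)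

⟪⟫-++ : ∀ (u v : List (ℤ × A)) f → ⟪ u ++ v ∣ f ⟫ ≡ ⟪ u ∣ f ⟫ + ⟪ v ∣ f ⟫
⟪⟫-++ []            v f = sym (ℤ.+-identityˡ _)
⟪⟫-++ ((c , x) ∷ u) v f =
  trans (cong (λ t → c * f x + t) (⟪⟫-++ u v f)) (sym (ℤ.+-assoc (c * f x) _ _))

⟪⟫-concatMap : ∀ (g : ℤ × A → List (ℤ × B)) (F : A → ℤ) {f} →
  (∀ c x → ⟪ g (c , x) ∣ f ⟫ ≡ c * F x) →
  ∀ u → ⟪ concatMap g u ∣ f ⟫ ≡ ⟪ u ∣ F ⟫
⟪⟫-concatMap g F         hyp []            = refl
⟪⟫-concatMap g F {f = f} hyp ((c , x) ∷ u) =
  trans (⟪⟫-++ (g (c , x)) (concatMap g u) f)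
        (cong₂ _+_ (hyp c x) (⟪⟫-concatMap g F hyp u))

δ : Word r → Word r → ℤ
δ []      []      = + 1
δ (a ∷ w) (b ∷ v) with a ≟L b
... | yes _ = δ w v
... | no  _ = + 0

δ-refl : ∀ (w : Word r) → δ w w ≡ + 1
δ-refl []      = refl
δ-refl (a ∷ w) with a ≟L a
... | yes _   = δ-refl w
... | no  a≢a = contradiction refl a≢a

δ-≢ : ∀ {w v : Word r} → w ≢ v → δ w v ≡ + 0
δ-≢ {w = []}    {[]}    w≢v = contradiction refl w≢v
δ-≢ {w = a ∷ w} {b ∷ v} w≢v with a ≟L b
... | yes refl = δ-≢ (λ w≡v → w≢v (cong (a ∷_) w≡v))
... | no  _    = refl

coeff≡⟪δ⟫ : ∀ (u : Tensor r) w → coeff u w ≡ ⟪ u ∣ δ w ⟫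
coeff≡⟪δ⟫ []            w = refl
coeff≡⟪δ⟫ ((c , v) ∷ u) w with ≡-dec _≟L_ v w
... | yes refl = cong₂ _+_ (sym (trans (cong (c *_) (δ-refl v)) (ℤ.*-identityʳ c))) (coeff≡⟪δ⟫ u v)
... | no  v≢w  = begin
  coeff u w                ≡⟨ coeff≡⟪δ⟫ u w ⟩
  ⟪ u ∣ δ w ⟫              ≡⟨ ℤ.+-identityˡ _ ⟨
  + 0 + ⟪ u ∣ δ w ⟫        ≡⟨ cong (_+ ⟪ u ∣ δ w ⟫) (ℤ.*-zeroʳ c) ⟨
  c * + 0 + ⟪ u ∣ δ w ⟫    ≡⟨ cong (λ t → c * t + ⟪ u ∣ δ w ⟫) (δ-≢ (v≢w ∘ sym)) ⟨
  c * δ w v + ⟪ u ∣ δ w ⟫  ∎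

⟪⟫-· : ∀ (u : Tensor (suc r)) (v : Tensor (suc s)) f →
  ⟪ u · v ∣ f ⟫ ≡ ⟪ u ∣ (λ a → ⟪ v ∣ (λ b → ⟪ chainW a b ∣ f ⟫) ⟫) ⟫
⟪⟫-· u v f = ⟪⟫-concatMap _ _ row u
  where
  row : ∀ c a →
    ⟪ concatMap (λ { (d , b) → map (λ { (e , w) → (c * d * e , w) }) (chainW a b) }) v ∣ f ⟫
      ≡ c * ⟪ v ∣ (λ b → ⟪ chainW a b ∣ f ⟫) ⟫
  row c a = trans (⟪⟫-concatMap _ (λ b → c * ⟪ chainW a b ∣ f ⟫) entry v) (⟪⟫-scale v c _)
    where
    entry : ∀ d b → ⟪ map (λ { (e , w) → (c * d * e , w) }) (chainW a b) ∣ f ⟫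
                      ≡ d * (c * ⟪ chainW a b ∣ f ⟫)
    entry d b = begin
      ⟪ map _ (chainW a b) ∣ f ⟫   ≡⟨ ⟪⟫-map-scale (chainW a b) (c * d) f ⟩
      c * d * ⟪ chainW a b ∣ f ⟫   ≡⟨ ℤ.*-assoc c d _ ⟩
      c * (d * ⟪ chainW a b ∣ f ⟫) ≡⟨ x∙yz≈y∙xz c d _ ⟩
      d * (c * ⟪ chainW a b ∣ f ⟫) ∎

⟪⟫-++· : ∀ (u u′ : Tensor (suc r)) (T : Tensor (suc s)) f →
  ⟪ (u ++ u′) · T ∣ f ⟫ ≡ ⟪ u · T ∣ f ⟫ + ⟪ u′ · T ∣ f ⟫
⟪⟫-++· u u′ T f = trans (cong ⟪_∣ f ⟫ (concatMap-++ _ u u′)) (⟪⟫-++ (u · T) (u′ · T) f)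

⟪⟫-basis· : ∀ (a : Word (suc r)) (T : Tensor (suc s)) f →
  ⟪ basis a · T ∣ f ⟫ ≡ ⟪ T ∣ (λ b → ⟪ chainW a b ∣ f ⟫) ⟫
⟪⟫-basis· a T f = trans (⟪⟫-· (basis a) T f) (⟪⟫-basis a (λ a′ → ⟪ T ∣ (λ b → ⟪ chainW a′ b ∣ f ⟫) ⟫))

⟪⟫-basis-∷· : ∀ x (a : Word (suc r)) (T : Tensor (suc s)) f →
  ⟪ basis (x ∷ a) · T ∣ f ⟫ ≡ ⟪ basis a · T ∣ f ∘ (x ∷_) ⟫
⟪⟫-basis-∷· x a@(_ ∷ _) T f = begin
  ⟪ basis (x ∷ a) · T ∣ f ⟫                   ≡⟨ ⟪⟫-basis· (x ∷ a) T f ⟩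
  ⟪ T ∣ (λ b → ⟪ chainW (x ∷ a) b ∣ f ⟫) ⟫     ≡⟨ ⟪⟫-cong T (λ b → ⟪⟫-map (chainW a b) (x ∷_) f) ⟩
  ⟪ T ∣ (λ b → ⟪ chainW a b ∣ f ∘ (x ∷_) ⟫) ⟫  ≡⟨ ⟪⟫-basis· a T (f ∘ (x ∷_)) ⟨
  ⟪ basis a · T ∣ f ∘ (x ∷_) ⟫                 ∎

chainW-Yˡ : ∀ (b : Word (suc s)) → chainW (Y ∷ []) b ≡ basis b
chainW-Yˡ (X ∷ _) = refl
chainW-Yˡ (Y ∷ _) = refl
chainW-Yˡ (Z ∷ _) = refl

⟪⟫-Yt· : ∀ (T : Tensor (suc s)) f → ⟪ Yt · T ∣ f ⟫ ≡ ⟪ T ∣ f ⟫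
⟪⟫-Yt· T f = trans (⟪⟫-basis· (Y ∷ []) T f)
  (⟪⟫-cong T (λ b → trans (cong ⟪_∣ f ⟫ (chainW-Yˡ b)) (⟪⟫-basis b f)))

subst-∷ : ∀ {m n} (e : m ≡ n) x (v : Word (suc n)) →
  subst (λ k → Word (suc k)) (sym (cong suc e)) (x ∷ v) ≡ x ∷ subst (λ k → Word (suc k)) (sym e) v
subst-∷ refl x v = refl

chainW-Yʳ : ∀ (a : Word (suc r)) →
  chainW a (Y ∷ []) ≡ basis (subst (λ k → Word (suc k)) (sym (+-identityʳ r)) a)
chainW-Yʳ (X ∷ []) = refl
chainW-Yʳ (Y ∷ []) = refl
chainW-Yʳ (Z ∷ []) = refl
chainW-Yʳ {suc r} (x ∷ a@(_ ∷ _)) =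
  trans (cong (map _) (chainW-Yʳ a)) (cong basis (sym (subst-∷ (+-identityʳ r) x a)))

⟪⟫-subst : ∀ {m n} (e : m ≡ n) (U : Tensor (suc m)) f →
  ⟪ subst (λ k → Tensor (suc k)) e U ∣ f ⟫ ≡ ⟪ U ∣ f ∘ subst (λ k → Word (suc k)) e ⟫
⟪⟫-subst refl U f = refl

⟪⟫-·Yt : ∀ (T : Tensor (suc r)) f →
  ⟪ subst (λ k → Tensor (suc k)) (+-identityʳ r) (T · Yt) ∣ f ⟫ ≡ ⟪ T ∣ f ⟫
⟪⟫-·Yt {r} T f = begin
  ⟪ subst (λ k → Tensor (suc k)) (+-identityʳ r) (T · Yt) ∣ f ⟫
    ≡⟨ ⟪⟫-subst (+-identityʳ r) (T · Yt) f ⟩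
  ⟪ T · Yt ∣ f ∘ cast ⟫
    ≡⟨ ⟪⟫-· T Yt (f ∘ cast) ⟩
  ⟪ T ∣ (λ a → ⟪ Yt ∣ (λ b → ⟪ chainW a b ∣ f ∘ cast ⟫) ⟫) ⟫
    ≡⟨ ⟪⟫-cong T unitʳ ⟩
  ⟪ T ∣ f ⟫
    ∎
  where
  cast : Word (suc (r ℕ.+ 0)) → Word (suc r)
  cast = subst (λ k → Word (suc k)) (+-identityʳ r)
  cast⁻¹ : Word (suc r) → Word (suc (r ℕ.+ 0))
  cast⁻¹ = subst (λ k → Word (suc k)) (sym (+-identityʳ r))
  unitʳ : ∀ a → ⟪ Yt ∣ (λ b → ⟪ chainW a b ∣ f ∘ cast ⟫) ⟫ ≡ f a
  unitʳ a = begin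
    ⟪ Yt ∣ (λ b → ⟪ chainW a b ∣ f ∘ cast ⟫) ⟫ ≡⟨ ⟪⟫-basis (Y ∷ []) (λ b → ⟪ chainW a b ∣ f ∘ cast ⟫) ⟩
    ⟪ chainW a (Y ∷ []) ∣ f ∘ cast ⟫           ≡⟨ cong ⟪_∣ f ∘ cast ⟫ (chainW-Yʳ a) ⟩
    ⟪ basis (cast⁻¹ a) ∣ f ∘ cast ⟫            ≡⟨ ⟪⟫-basis (cast⁻¹ a) (f ∘ cast) ⟩
    f (cast (cast⁻¹ a))                        ≡⟨ cong f (subst-subst-sym (+-identityʳ r)) ⟩
    f a                                        ∎

⟪⟫-P· : ∀ (T : Tensor (suc s)) f →
  ⟪ P · T ∣ f ⟫ ≡ ⟪ T ∣ f ∘ (X ∷_) ⟫ + ⟪ basis (X ∷ []) · T ∣ f ∘ (Y ∷_) ⟫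
⟪⟫-P· T f = begin
  ⟪ P · T ∣ f ⟫
    ≡⟨ ⟪⟫-++· (basis (X ∷ Y ∷ [])) (basis (Y ∷ X ∷ [])) T f ⟩
  ⟪ basis (X ∷ Y ∷ []) · T ∣ f ⟫ + ⟪ basis (Y ∷ X ∷ []) · T ∣ f ⟫
    ≡⟨ cong₂ _+_ (⟪⟫-basis-∷· X (Y ∷ []) T f) (⟪⟫-basis-∷· Y (X ∷ []) T f) ⟩
  ⟪ Yt · T ∣ f ∘ (X ∷_) ⟫ + ⟪ basis (X ∷ []) · T ∣ f ∘ (Y ∷_) ⟫
    ≡⟨ cong (_+ ⟪ basis (X ∷ []) · T ∣ f ∘ (Y ∷_) ⟫) (⟪⟫-Yt· T (f ∘ (X ∷_))) ⟩
  ⟪ T ∣ f ∘ (X ∷_) ⟫ + ⟪ basis (X ∷ []) · T ∣ f ∘ (Y ∷_) ⟫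
    ∎

coeff-basis· : ∀ (a : Word (suc r)) (T : Tensor (suc s)) w →
  coeff (basis a · T) w ≡ ⟪ T ∣ (λ b → ⟪ chainW a b ∣ δ w ⟫) ⟫
coeff-basis· a T w = trans (coeff≡⟪δ⟫ (basis a · T) w) (⟪⟫-basis· a T (δ w))

coeff-X·-X : ∀ (T : Tensor (suc s)) w → coeff (basis (X ∷ []) · T) (X ∷ w) ≡ coeff T (Y ∷ w)
coeff-X·-X T w = begin
  coeff (basis (X ∷ []) · T) (X ∷ w)                    ≡⟨ coeff-basis· (X ∷ []) T (X ∷ w) ⟩
  ⟪ T ∣ (λ b → ⟪ chainW (X ∷ []) b ∣ δ (X ∷ w) ⟫) ⟫   ≡⟨ ⟪⟫-cong T XY≡X ⟩
  ⟪ T ∣ δ (Y ∷ w) ⟫                                    ≡⟨ coeff≡⟪δ⟫ T (Y ∷ w) ⟨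
  coeff T (Y ∷ w)                                      ∎
  where
  XY≡X : ∀ b → ⟪ chainW (X ∷ []) b ∣ δ (X ∷ w) ⟫ ≡ δ (Y ∷ w) b
  XY≡X (X ∷ v) = refl
  XY≡X (Y ∷ v) = ⟪⟫-basis (X ∷ v) (δ (X ∷ w))
  XY≡X (Z ∷ v) = refl

coeff-X·-Y : ∀ (T : Tensor (suc s)) w → coeff (basis (X ∷ []) · T) (Y ∷ w) ≡ + 0
coeff-X·-Y T w = begin
  coeff (basis (X ∷ []) · T) (Y ∷ w)                    ≡⟨ coeff-basis· (X ∷ []) T (Y ∷ w) ⟩
  ⟪ T ∣ (λ b → ⟪ chainW (X ∷ []) b ∣ δ (Y ∷ w) ⟫) ⟫   ≡⟨ ⟪⟫-cong T no-Y ⟩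
  ⟪ T ∣ (λ _ → + 0) ⟫                                  ≡⟨ ⟪⟫-zero T ⟩
  + 0                                                  ∎
  where
  no-Y : ∀ b → ⟪ chainW (X ∷ []) b ∣ δ (Y ∷ w) ⟫ ≡ + 0
  no-Y (X ∷ v) = refl
  no-Y (Y ∷ v) = refl
  no-Y (Z ∷ v) = refl

coeff-X·-Z : ∀ (T : Tensor (suc s)) w →
  coeff (basis (X ∷ []) · T) (Z ∷ w) ≡ + 2 * coeff T (X ∷ w)
coeff-X·-Z T w = begin
  coeff (basis (X ∷ []) · T) (Z ∷ w)                    ≡⟨ coeff-basis· (X ∷ []) T (Z ∷ w) ⟩
  ⟪ T ∣ (λ b → ⟪ chainW (X ∷ []) b ∣ δ (Z ∷ w) ⟫) ⟫   ≡⟨ ⟪⟫-cong T XX≡2Z ⟩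
  ⟪ T ∣ (λ b → + 2 * δ (X ∷ w) b) ⟫                    ≡⟨ ⟪⟫-scale T (+ 2) (δ (X ∷ w)) ⟩
  + 2 * ⟪ T ∣ δ (X ∷ w) ⟫                              ≡⟨ cong (+ 2 *_) (coeff≡⟪δ⟫ T (X ∷ w)) ⟨
  + 2 * coeff T (X ∷ w)                                ∎
  where
  XX≡2Z : ∀ b → ⟪ chainW (X ∷ []) b ∣ δ (Z ∷ w) ⟫ ≡ + 2 * δ (X ∷ w) b
  XX≡2Z (X ∷ v) = ℤ.+-identityʳ (+ 2 * δ w v)
  XX≡2Z (Y ∷ v) = refl
  XX≡2Z (Z ∷ v) = refl

coeff-P·-X : ∀ (T : Tensor (suc s)) w → coeff (P · T) (X ∷ w) ≡ coeff T w
coeff-P·-X T w = begin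
  coeff (P · T) (X ∷ w)
    ≡⟨ coeff≡⟪δ⟫ (P · T) (X ∷ w) ⟩
  ⟪ P · T ∣ δ (X ∷ w) ⟫
    ≡⟨ ⟪⟫-P· T (δ (X ∷ w)) ⟩
  ⟪ T ∣ δ w ⟫ + ⟪ basis (X ∷ []) · T ∣ (λ _ → + 0) ⟫
    ≡⟨ cong (_+_ ⟪ T ∣ δ w ⟫) (⟪⟫-zero (basis (X ∷ []) · T)) ⟩
  ⟪ T ∣ δ w ⟫ + + 0
    ≡⟨ ℤ.+-identityʳ _ ⟩
  ⟪ T ∣ δ w ⟫
    ≡⟨ coeff≡⟪δ⟫ T w ⟨
  coeff T w
    ∎

coeff-P·-Y : ∀ (T : Tensor (suc s)) w → coeff (P · T) (Y ∷ w) ≡ coeff (basis (X ∷ []) · T) w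
coeff-P·-Y T w = begin
  coeff (P · T) (Y ∷ w)
    ≡⟨ coeff≡⟪δ⟫ (P · T) (Y ∷ w) ⟩
  ⟪ P · T ∣ δ (Y ∷ w) ⟫
    ≡⟨ ⟪⟫-P· T (δ (Y ∷ w)) ⟩
  ⟪ T ∣ (λ _ → + 0) ⟫ + ⟪ basis (X ∷ []) · T ∣ δ w ⟫
    ≡⟨ cong (_+ ⟪ basis (X ∷ []) · T ∣ δ w ⟫) (⟪⟫-zero T) ⟩
  + 0 + ⟪ basis (X ∷ []) · T ∣ δ w ⟫
    ≡⟨ ℤ.+-identityˡ _ ⟩
  ⟪ basis (X ∷ []) · T ∣ δ w ⟫
    ≡⟨ coeff≡⟪δ⟫ (basis (X ∷ []) · T) w ⟨
  coeff (basis (X ∷ []) · T) w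
    ∎

coeff-P·-Z : ∀ (T : Tensor (suc s)) w → coeff (P · T) (Z ∷ w) ≡ + 0
coeff-P·-Z T w = begin
  coeff (P · T) (Z ∷ w)
    ≡⟨ coeff≡⟪δ⟫ (P · T) (Z ∷ w) ⟩
  ⟪ P · T ∣ δ (Z ∷ w) ⟫
    ≡⟨ ⟪⟫-P· T (δ (Z ∷ w)) ⟩
  ⟪ T ∣ (λ _ → + 0) ⟫ + ⟪ basis (X ∷ []) · T ∣ (λ _ → + 0) ⟫
    ≡⟨ cong₂ _+_ (⟪⟫-zero T) (⟪⟫-zero (basis (X ∷ []) · T)) ⟩
  + 0
    ∎

ZeroOr2^ : ℕ → ℤ → Set
ZeroOr2^ n c = c ≡ + 0 ⊎ c ≡ + (2 ^ n)

ZeroOr2^-double : ∀ n {c} → ZeroOr2^ n c → ZeroOr2^ (suc n) (+ 2 * c)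
ZeroOr2^-double n (inj₁ refl) = inj₁ refl
ZeroOr2^-double n (inj₂ refl) = inj₂ (sym (ℤ.pos-* 2 (2 ^ n)))

CoeffsZeroOr2^#Z : Tensor r → Set
CoeffsZeroOr2^#Z u = ∀ w → ZeroOr2^ (#Z w) (coeff u w)

coeffs-Yt : CoeffsZeroOr2^#Z Yt
coeffs-Yt (X ∷ []) = inj₁ refl
coeffs-Yt (Y ∷ []) = inj₂ refl
coeffs-Yt (Z ∷ []) = inj₁ refl

coeffs-X· : ∀ (T : Tensor (suc s)) → CoeffsZeroOr2^#Z T → CoeffsZeroOr2^#Z (basis (X ∷ []) · T)
coeffs-X· T h (X ∷ w) rewrite coeff-X·-X T w = h (Y ∷ w)
coeffs-X· T h (Y ∷ w) rewrite coeff-X·-Y T w = inj₁ refl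
coeffs-X· T h (Z ∷ w) rewrite coeff-X·-Z T w = ZeroOr2^-double (#Z w) (h (X ∷ w))

coeffs-P· : ∀ (T : Tensor (suc s)) → CoeffsZeroOr2^#Z T → CoeffsZeroOr2^#Z (P · T)
coeffs-P· T h (X ∷ w) rewrite coeff-P·-X T w = h w
coeffs-P· T h (Y ∷ w) rewrite coeff-P·-Y T w = coeffs-X· T h w
coeffs-P· T h (Z ∷ w) rewrite coeff-P·-Z T w = inj₁ refl

coeffs-Ppow : ∀ m → CoeffsZeroOr2^#Z (Ppow m)
coeffs-Ppow zero    = coeffs-Yt
coeffs-Ppow (suc m) = coeffs-P· (Ppow m) (coeffs-Ppow m)

coeff-YPY : ∀ m w → coeff (YPY m) w ≡ coeff (Ppow m) w
coeff-YPY m w = begin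
  coeff (YPY m) w                   ≡⟨ coeff≡⟪δ⟫ (YPY m) w ⟩
  ⟪ YPY m ∣ δ w ⟫                   ≡⟨ ⟪⟫-·Yt (Yt · Ppow m) (δ w) ⟩
  ⟪ Yt · Ppow m ∣ δ w ⟫             ≡⟨ ⟪⟫-Yt· (Ppow m) (δ w) ⟩
  ⟪ Ppow m ∣ δ w ⟫                  ≡⟨ coeff≡⟪δ⟫ (Ppow m) w ⟨
  coeff (Ppow m) w                  ∎

lemma5p8 : (m : ℕ) → 1 ≤ m → (w : Word (suc m)) →
    coeff (YPY m) w ≢ + 0 → coeff (YPY m) w ≡ + (2 ^ #Z w)
-- P⁰ = Y has the property as well.
lemma5p8 m _ w c≢0 with coeffs-Ppow m w
... | inj₁ c≡0  = contradiction (trans (coeff-YPY m w) c≡0) c≢0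
... | inj₂ c≡2ⁿ = trans (coeff-YPY m w) c≡2ⁿ
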